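{- Let $\pi\in\mathfrak{B}_n$ with $\pi^{ -1}=\pi$ and let $1\le i\le n$. If $\pi_i=i$ then $\varphi_{(i+1,i)}(\pi)$ is a signed involution in $\mathfrak{B}_{n+1}$, and if $\pi_i=-i$ then $\overline{\varphi}_{(i+1,i)}(\pi)$ is a signed involution in $\mathfrak{B}_{n+1}$.
   Context: $\mathfrak{B}_n$ is the set of signed permutations $\pi=\pi_1\cdots\pi_n$ ($\pi_i\in\{\pm1,\dots,\pm n\}$, $|\pi_1|,\dots,|\pi_n|$ a permutation of $[n]$); the inverse is given by $\pi^{ -1}_{|\pi_i|}=\operatorname{sgn}(\pi_i)\,i$, and $\pi$ is a signed involution if $\pi^{ -1}=\pi$. For $\pi\in\mathfrak{B}_n$ and $i,j\in[n+1]$, $\varphi_{(i,j)}(\pi)$ is the $\sigma\in\mathfrak{B}_{n+1}$ with $\sigma_i=j$, $\sigma_k=s(\pi_k)$ for $k<i$ and $\sigma_k=s(\pi_{k-1})$ for $k>i$, where $s(x)=x$ if $|x|<j$, $s(x)=x+1$ if $x\ge j$, $s(x)=x-1$ if $x\le -j$; $\overline{\varphi}_{(i,j)}(\pi)$ is defined identically except that $\sigma_i=-j$. (Geometrically, in the grid of $\pi$ a positive, resp. negative, filled square is inserted at the grid point $(i,j)$, i.e. a new row $i$ and column $j$ are created.) -}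

module Defs where

open import Data.Nat using (ℕ; zero; suc; _≤_)
open import Data.Integer using (ℤ; +_; -_; _+_; _-_; ∣_∣; sign; _◃_; _≤ᵇ_)
open import Data.Bool using (Bool; true; false; if_then_else_)
open import Data.Vec using (Vec; []; _∷_; map)
open import Data.Product using (_×_)
open import Relation.Binary.PropositionalEquality using (_≡_)
import Data.Nat as ℕ

-- A word π = π₁ ⋯ πₙ is a vector of integers; positions are 1-based.
-- at π k = π_k for 1 ≤ k ≤ n (and 0 outside this range, never used there).
at : ∀ {n} → Vec ℤ n → ℕ → ℤ
at []       _             = + 0
at (x ∷ xs) zero          = + 0
at (x ∷ xs) (suc zero)    = x
at (x ∷ xs) (suc (suc k)) = at xs (suc k)

IsSignedPerm : ∀ n → Vec ℤ n → Set
IsSignedPerm n π =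
  (∀ k → 1 ≤ k → k ≤ n → 1 ≤ ∣ at π k ∣ × ∣ at π k ∣ ≤ n) ×
  (∀ k l → 1 ≤ k → k ≤ n → 1 ≤ l → l ≤ n → ∣ at π k ∣ ≡ ∣ at π l ∣ → k ≡ l)

-- The inverse is given by π⁻¹_{|πₖ|} = sgn(πₖ)·k; π⁻¹ = π means exactly
-- π_{|πₖ|} = sgn(πₖ)·k for every k ∈ [n].
IsSignedInvolution : ∀ n → Vec ℤ n → Set
IsSignedInvolution n π =
  IsSignedPerm n π ×
  (∀ k → 1 ≤ k → k ≤ n → at π ∣ at π k ∣ ≡ sign (at π k) ◃ k)

shift : ℕ → ℤ → ℤ
shift j x =
  if ∣ x ∣ ℕ.<ᵇ j then x
  else (if (+ j) ≤ᵇ x then x + + 1 else x - + 1)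

ins : ∀ {n} → ℕ → ℤ → Vec ℤ n → Vec ℤ (suc n)
ins zero          a xs       = a ∷ xs
ins (suc zero)    a xs       = a ∷ xs
ins (suc (suc k)) a []       = a ∷ []
ins (suc (suc k)) a (x ∷ xs) = x ∷ ins (suc k) a xs

φ : ∀ {n} → ℕ → ℕ → Vec ℤ n → Vec ℤ (suc n)
φ i j π = ins i (+ j) (map (shift j) π)

φ̄ : ∀ {n} → ℕ → ℕ → Vec ℤ n → Vec ℤ (suc n)
φ̄ i j π = ins i (- (+ j)) (map (shift j) π)

-- Write ι = punchIn (suc i) for the renumbering of positions and of absolute values
-- caused by the new row and column. On absolute values the relabelling s(x) of φ_{(i+1,i)} is
-- punchIn i, which agrees with ι everywhere except at i, where it gives i+1. Hence
-- σ(ι k) = sgn(πₖ)·punchIn i |πₖ| and σ(i+1) = ±i: the fixed point ±i of π becomes the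
-- signed 2-cycle (i i+1) of σ, and every other relation π_{|πₖ|} = sgn(πₖ)·k is carried
-- over by ι. Injectivity of |σ| follows since punchIn i is injective and misses i.
module Submission where

open import Defs
open import Data.Nat using (ℕ; suc; _≤_)
open import Data.Integer using (ℤ; +_; -_)
open import Data.Vec using (Vec)
open import Data.Product using (_×_)
open import Relation.Binary.PropositionalEquality using (_≡_)

open import Data.Nat as ℕ using (zero; _<_; z≤n; s≤s; >-nonZero)
open import Data.Nat.Properties
  using (suc-injective; ≤-refl; ≤-trans; ≤-pred; <-≤-trans; ≮⇒≥; n≤1+n; n<1+n; m≤n⇒m≤1+n; +-comm;
         +-identityʳ; _≟_; _<?_; <ᵇ-reflects-<; ≤ᵇ-reflects-≤)
open import Data.Integer using (-[1+_]; ∣_∣; sign; _◃_)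
open import Data.Integer.Properties using (sign-◃; abs-◃)
open import Data.Sign using (Sign)
open import Data.Vec using (_∷_; map)
open import Data.Product using (_,_; proj₁; proj₂)
open import Data.Bool using (true; false)
open import Function using (_∘_)
open import Relation.Nullary using (yes; no; contradiction)
open import Relation.Nullary.Reflects using (ofʸ; ofⁿ)
open import Relation.Binary.PropositionalEquality
  using (refl; sym; trans; cong; cong₂; subst; _≢_; module ≡-Reasoning)

punchIn : ℕ → ℕ → ℕ
punchIn zero    m       = suc m
punchIn (suc j) zero    = zero
punchIn (suc j) (suc m) = suc (punchIn j m)

punchIn-< : ∀ {j m} → m < j → punchIn j m ≡ m
punchIn-< {suc j} {zero}  _         = refl
punchIn-< {suc j} {suc m} (s≤s m<j) = cong suc (punchIn-< m<j)

punchIn-≥ : ∀ {j m} → j ≤ m → punchIn j m ≡ suc m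
punchIn-≥ {zero}  _         = refl
punchIn-≥ {suc j} (s≤s j≤m) = cong suc (punchIn-≥ j≤m)

punchIn-suc : ∀ {j m} → m ≢ j → punchIn (suc j) m ≡ punchIn j m
punchIn-suc {zero}  {zero}  m≢j = contradiction refl m≢j
punchIn-suc {suc j} {zero}  _   = refl
punchIn-suc {zero}  {suc m} _   = refl
punchIn-suc {suc j} {suc m} m≢j = cong suc (punchIn-suc (m≢j ∘ cong suc))

punchIn-injective : ∀ j {m l} → punchIn j m ≡ punchIn j l → m ≡ l
punchIn-injective zero    e = suc-injective e
punchIn-injective (suc j) {zero}  {zero}  _ = refl
punchIn-injective (suc j) {suc m} {suc l} e = cong suc (punchIn-injective j (suc-injective e))

punchIn-≢ : ∀ j m → punchIn j m ≢ j
punchIn-≢ zero    m       ()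
punchIn-≢ (suc j) zero    ()
punchIn-≢ (suc j) (suc m) e = punchIn-≢ j m (suc-injective e)

m≤punchIn : ∀ j m → m ≤ punchIn j m
m≤punchIn zero    m       = n≤1+n m
m≤punchIn (suc j) zero    = z≤n
m≤punchIn (suc j) (suc m) = s≤s (m≤punchIn j m)

punchIn≤suc : ∀ j m → punchIn j m ≤ suc m
punchIn≤suc zero    m       = s≤s ≤-refl
punchIn≤suc (suc j) zero    = z≤n
punchIn≤suc (suc j) (suc m) = s≤s (punchIn≤suc j m)

punchIn-reflects-≤ : ∀ {j m n} → j ≤ suc n → punchIn j m ≤ suc n → m ≤ n
punchIn-reflects-≤ {j} {m} j≤1+n p≤1+n with m <? j
... | yes m<j = ≤-pred (<-≤-trans m<j j≤1+n)
... | no  m≮j = ≤-pred (subst (_≤ _) (punchIn-≥ (≮⇒≥ m≮j)) p≤1+n)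

punchIn-reflects-positive : ∀ {j m} → 1 ≤ punchIn (suc j) m → 1 ≤ m
punchIn-reflects-positive {m = suc m} _ = s≤s z≤n

data PunchInView (j : ℕ) : ℕ → Set where
  hole    : PunchInView j j
  punched : ∀ m → PunchInView j (punchIn j m)

punchInView : ∀ j p → PunchInView j p
punchInView zero    zero    = hole
punchInView zero    (suc p) = punched p
punchInView (suc j) zero    = punched zero
punchInView (suc j) (suc p) with punchInView j p
... | hole      = hole
... | punched m = punched (suc m)

shift-◃ : ∀ j x → 1 ≤ ∣ x ∣ → shift j x ≡ sign x ◃ punchIn j ∣ x ∣
shift-◃ j (+ suc m) _ with suc m ℕ.<ᵇ j | <ᵇ-reflects-< (suc m) j
... | true  | ofʸ m<j rewrite punchIn-< m<j = refl
... | false | ofⁿ m≮j rewrite punchIn-≥ (≮⇒≥ m≮j) with j ℕ.≤ᵇ suc m | ≤ᵇ-reflects-≤ j (suc m)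
...   | true  | _        = cong (+_ ∘ suc) (+-comm m 1)
...   | false | ofⁿ j≰m = contradiction (≮⇒≥ m≮j) j≰m
shift-◃ j -[1+ m ] _ with suc m ℕ.<ᵇ j | <ᵇ-reflects-< (suc m) j
... | true  | ofʸ m<j rewrite punchIn-< m<j = refl
... | false | ofⁿ m≮j rewrite punchIn-≥ (≮⇒≥ m≮j) = cong (λ t → -[1+ suc t ]) (+-identityʳ m)

at-map : ∀ {n} (f : ℤ → ℤ) (xs : Vec ℤ n) {k} → 1 ≤ k → k ≤ n → at (map f xs) k ≡ f (at xs k)
at-map f (x ∷ xs) {suc zero}    _ _         = refl
at-map f (x ∷ xs) {suc (suc k)} _ (s≤s k≤n) = at-map f xs (s≤s z≤n) k≤n

at-ins : ∀ {n} i a (xs : Vec ℤ n) → i ≤ n → at (ins (suc i) a xs) (suc i) ≡ a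
at-ins zero    a xs       _         = refl
at-ins (suc i) a (x ∷ xs) (s≤s i≤n) = at-ins i a xs i≤n

at-ins-punchIn : ∀ {n} i a (xs : Vec ℤ n) {k} → 1 ≤ k → k ≤ n →
  at (ins i a xs) (punchIn i k) ≡ at xs k
at-ins-punchIn zero          a xs       {suc k}       _ _         = refl
at-ins-punchIn (suc zero)    a xs       {suc k}       _ _         = refl
at-ins-punchIn (suc (suc i)) a (x ∷ xs) {suc zero}    _ _         = refl
at-ins-punchIn (suc (suc i)) a (x ∷ xs) {suc (suc k)} _ (s≤s k≤n) =
  at-ins-punchIn (suc i) a xs (s≤s z≤n) k≤n

module FixedPointDoubling {n} (π : Vec ℤ n) (inv : IsSignedInvolution n π)
  (j : ℕ) (s : Sign) (i≤n : suc j ≤ n) (πᵢ : at π (suc j) ≡ s ◃ suc j) where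

  open ≡-Reasoning

  private
    i : ℕ
    i = suc j

    bounded : ∀ k → 1 ≤ k → k ≤ n → 1 ≤ ∣ at π k ∣ × ∣ at π k ∣ ≤ n
    bounded = proj₁ (proj₁ inv)

  σ : Vec ℤ (suc n)
  σ = ins (suc i) (s ◃ i) (map (shift i) π)

  σ-new : at σ (suc i) ≡ s ◃ i
  σ-new = at-ins i (s ◃ i) (map (shift i) π) i≤n

  σ-old : ∀ {k} → 1 ≤ k → k ≤ n → at σ (punchIn (suc i) k) ≡ sign (at π k) ◃ punchIn i ∣ at π k ∣
  σ-old {k} 1≤k k≤n = begin
    at σ (punchIn (suc i) k)  ≡⟨ at-ins-punchIn (suc i) (s ◃ i) (map (shift i) π) 1≤k k≤n ⟩
    at (map (shift i) π) k    ≡⟨ at-map (shift i) π 1≤k k≤n ⟩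
    shift i (at π k)          ≡⟨ shift-◃ i (at π k) (proj₁ (bounded k 1≤k k≤n)) ⟩
    sign (at π k) ◃ punchIn i ∣ at π k ∣ ∎

  ∣σ-new∣ : ∣ at σ (suc i) ∣ ≡ i
  ∣σ-new∣ = trans (cong ∣_∣ σ-new) (abs-◃ s i)

  ∣σ-old∣ : ∀ {k} → 1 ≤ k → k ≤ n → ∣ at σ (punchIn (suc i) k) ∣ ≡ punchIn i ∣ at π k ∣
  ∣σ-old∣ 1≤k k≤n = trans (cong ∣_∣ (σ-old 1≤k k≤n)) (abs-◃ _ _)

  σ-fixed : at σ i ≡ s ◃ suc i
  σ-fixed = begin
    at σ i                                  ≡⟨ cong (at σ) (punchIn-< (n<1+n i)) ⟨
    at σ (punchIn (suc i) i)                ≡⟨ σ-old (s≤s z≤n) i≤n ⟩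
    sign (at π i) ◃ punchIn i ∣ at π i ∣    ≡⟨ cong (λ x → sign x ◃ punchIn i ∣ x ∣) πᵢ ⟩
    sign (s ◃ i) ◃ punchIn i ∣ s ◃ i ∣      ≡⟨ cong₂ (λ t m → t ◃ punchIn i m) (sign-◃ s i) (abs-◃ s i) ⟩
    s ◃ punchIn i i                         ≡⟨ cong (s ◃_) (punchIn-≥ ≤-refl) ⟩
    s ◃ suc i                               ∎

  ∣π∣≢i : ∀ {k} → 1 ≤ k → k ≤ n → k ≢ i → ∣ at π k ∣ ≢ i
  ∣π∣≢i {k} 1≤k k≤n k≢i ∣πₖ∣≡i =
    k≢i (proj₂ (proj₁ inv) k i 1≤k k≤n (s≤s z≤n) i≤n
          (trans ∣πₖ∣≡i (sym (trans (cong ∣_∣ πᵢ) (abs-◃ s i)))))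

  data Position : ℕ → Set where
    new : Position (suc i)
    old : ∀ {k} → 1 ≤ k → k ≤ n → Position (punchIn (suc i) k)

  position : ∀ {p} → 1 ≤ p → p ≤ suc n → Position p
  position {p} 1≤p p≤1+n with punchInView (suc i) p
  ... | hole      = new
  ... | punched k = old (punchIn-reflects-positive 1≤p) (punchIn-reflects-≤ (s≤s i≤n) p≤1+n)

  σ-bounded : ∀ p → 1 ≤ p → p ≤ suc n → 1 ≤ ∣ at σ p ∣ × ∣ at σ p ∣ ≤ suc n
  σ-bounded p 1≤p p≤1+n with position 1≤p p≤1+n
  ... | new rewrite ∣σ-new∣ = s≤s z≤n , m≤n⇒m≤1+n i≤n
  ... | old {k} 1≤k k≤n rewrite ∣σ-old∣ 1≤k k≤n with bounded k 1≤k k≤n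
  ...   | 1≤m , m≤n = ≤-trans 1≤m (m≤punchIn i _) , ≤-trans (punchIn≤suc i _) (s≤s m≤n)

  ∣σ∣-injective : ∀ p q → 1 ≤ p → p ≤ suc n → 1 ≤ q → q ≤ suc n → ∣ at σ p ∣ ≡ ∣ at σ q ∣ → p ≡ q
  ∣σ∣-injective p q 1≤p p≤1+n 1≤q q≤1+n e with position 1≤p p≤1+n | position 1≤q q≤1+n
  ... | new | new = refl
  ... | new | old 1≤l l≤n =
    contradiction (trans (sym ∣σ-new∣) (trans e (∣σ-old∣ 1≤l l≤n))) (punchIn-≢ i _ ∘ sym)
  ... | old 1≤k k≤n | new =
    contradiction (trans (sym (∣σ-old∣ 1≤k k≤n)) (trans e ∣σ-new∣)) (punchIn-≢ i _)
  ... | old {k} 1≤k k≤n | old {l} 1≤l l≤n =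
    cong (punchIn (suc i)) (proj₂ (proj₁ inv) k l 1≤k k≤n 1≤l l≤n
      (punchIn-injective i (trans (sym (∣σ-old∣ 1≤k k≤n)) (trans e (∣σ-old∣ 1≤l l≤n)))))

  InvolutiveAt : ℕ → Set
  InvolutiveAt p = at σ ∣ at σ p ∣ ≡ sign (at σ p) ◃ p

  involutive-new : InvolutiveAt (suc i)
  involutive-new = begin
    at σ ∣ at σ (suc i) ∣        ≡⟨ cong (at σ) ∣σ-new∣ ⟩
    at σ i                       ≡⟨ σ-fixed ⟩
    s ◃ suc i                    ≡⟨ cong (_◃ suc i) (sign-◃ s i) ⟨
    sign (s ◃ i) ◃ suc i         ≡⟨ cong (λ x → sign x ◃ suc i) σ-new ⟨
    sign (at σ (suc i)) ◃ suc i  ∎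

  involutive-fixed : InvolutiveAt i
  involutive-fixed = begin
    at σ ∣ at σ i ∣          ≡⟨ cong (at σ ∘ ∣_∣) σ-fixed ⟩
    at σ ∣ s ◃ suc i ∣       ≡⟨ cong (at σ) (abs-◃ s (suc i)) ⟩
    at σ (suc i)             ≡⟨ σ-new ⟩
    s ◃ i                    ≡⟨ cong (_◃ i) (sign-◃ s (suc i)) ⟨
    sign (s ◃ suc i) ◃ i     ≡⟨ cong (λ x → sign x ◃ i) σ-fixed ⟨
    sign (at σ i) ◃ i        ∎

  involutive-old : ∀ {k} → 1 ≤ k → k ≤ n → k ≢ i → InvolutiveAt (punchIn (suc i) k)
  involutive-old {k} 1≤k k≤n k≢i = begin
    at σ ∣ at σ (punchIn (suc i) k) ∣         ≡⟨ cong (at σ) (∣σ-old∣ 1≤k k≤n) ⟩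
    at σ (punchIn i m)                        ≡⟨ cong (at σ) (punchIn-suc m≢i) ⟨
    at σ (punchIn (suc i) m)                  ≡⟨ σ-old 1≤m m≤n ⟩
    sign (at π m) ◃ punchIn i ∣ at π m ∣      ≡⟨ cong (λ x → sign x ◃ punchIn i ∣ x ∣) (proj₂ inv k 1≤k k≤n) ⟩
    sign (t ◃ k) ◃ punchIn i ∣ t ◃ k ∣        ≡⟨ cong₂ (λ u v → u ◃ punchIn i v) (sign-◃ t k {{>-nonZero 1≤k}}) (abs-◃ t k) ⟩
    t ◃ punchIn i k                           ≡⟨ cong (t ◃_) (punchIn-suc k≢i) ⟨
    t ◃ punchIn (suc i) k                     ≡⟨ cong (_◃ punchIn (suc i) k) (sign-◃ t (punchIn i m) {{>-nonZero 1≤σ}}) ⟨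
    sign (t ◃ punchIn i m) ◃ punchIn (suc i) k ≡⟨ cong (λ x → sign x ◃ punchIn (suc i) k) (σ-old 1≤k k≤n) ⟨
    sign (at σ (punchIn (suc i) k)) ◃ punchIn (suc i) k ∎
    where
    m : ℕ
    m = ∣ at π k ∣
    t : Sign
    t = sign (at π k)
    1≤m : 1 ≤ m
    1≤m = proj₁ (bounded k 1≤k k≤n)
    m≤n : m ≤ n
    m≤n = proj₂ (bounded k 1≤k k≤n)
    m≢i : m ≢ i
    m≢i = ∣π∣≢i 1≤k k≤n k≢i
    1≤σ : 1 ≤ punchIn i m
    1≤σ = ≤-trans 1≤m (m≤punchIn i m)

  σ-involutive : ∀ p → 1 ≤ p → p ≤ suc n → InvolutiveAt p
  σ-involutive p 1≤p p≤1+n with position 1≤p p≤1+n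
  ... | new = involutive-new
  ... | old {k} 1≤k k≤n with k ≟ i
  ...   | yes refl = subst InvolutiveAt (sym (punchIn-< (n<1+n i))) involutive-fixed
  ...   | no  k≢i  = involutive-old 1≤k k≤n k≢i

  isSignedInvolution : IsSignedInvolution (suc n) σ
  isSignedInvolution = (σ-bounded , ∣σ∣-injective) , σ-involutive

proposition2p2 : ∀ n (π : Vec ℤ n) → IsSignedPerm n π → IsSignedInvolution n π →
    ∀ i → 1 ≤ i → i ≤ n →
      (at π i ≡ + i → IsSignedInvolution (suc n) (φ (suc i) i π)) ×
      (at π i ≡ - (+ i) → IsSignedInvolution (suc n) (φ̄ (suc i) i π))
-- The IsSignedPerm hypothesis is part of IsSignedInvolution, hence unused.
proposition2p2 n π _ inv (suc j) _ i≤n =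
  FixedPointDoubling.isSignedInvolution π inv j Sign.+ i≤n ,
  FixedPointDoubling.isSignedInvolution π inv j Sign.- i≤n
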